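{- Let $A=(a_{ij})\in\mathbb{Z}^{d\times n}$, $b\in\mathbb{Z}^d$, $u\in\mathbb{Z}^n_{\ge 0}$, let $\Delta=\|A\|_\infty$, $U=\sum_{j=1}^n u_j$, and $$M=\Delta U+\max(\|b\|_\infty,\|u\|_\infty)+\Delta+2.$$ Then a vector $(x,s)\in\mathbb{Z}^{n}_{\ge0}\times\mathbb{Z}^{n+1}_{\ge 0}$ (with $x=(x_1,\dots,x_n)$, $s=(s_1,\dots,s_{n+1})$) satisfies the system $$\sum_{j=1}^n a_{ij}x_j=b_i\ (i\in[d]),\qquad x_j+s_j=u_j\ (j\in[n]),\qquad \sum_{j=1}^n(x_j+s_j)+s_{n+1}=U$$ (equivalently, this system with the $i$-th equation multiplied by $M^{i-1}$, the equation for $j$ multiplied by $M^{d+j-1}$ and the last equation multiplied by $M^{d+n}$) if and only if it satisfies the single equation $$\sum_{i=1}^d M^{i-1}\sum_{j=1}^n a_{ij}x_j+\sum_{j=1}^n M^{d+j-1}(x_j+s_j)+M^{d+n}\Big(\sum_{j=1}^n(x_j+s_j)+s_{n+1}\Big)=\sum_{i=1}^d M^{i-1}b_i+\sum_{j=1}^n M^{d+j-1}u_j+M^{d+n}U.$$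
   Context: $\|A\|_\infty$ denotes the largest absolute value of an entry of $A$; $[n]=\{1,\dots,n\}$. -}

module Defs where

open import Data.Nat as ℕ using (ℕ; zero; suc; _⊔_)
open import Data.Integer as ℤ using (ℤ; +_; ∣_∣)
open import Data.Fin using (Fin; zero; suc)

Σℤ : (n : ℕ) → (Fin n → ℤ) → ℤ
Σℤ zero    f = + 0
Σℤ (suc n) f = f zero ℤ.+ Σℤ n (λ j → f (suc j))

Σℕ : (n : ℕ) → (Fin n → ℕ) → ℕ
Σℕ zero    f = 0
Σℕ (suc n) f = f zero ℕ.+ Σℕ n (λ j → f (suc j))

maxℕ : (n : ℕ) → (Fin n → ℕ) → ℕ
maxℕ zero    f = 0
maxℕ (suc n) f = f zero ⊔ maxℕ n (λ j → f (suc j))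

normMat : (d n : ℕ) → (Fin d → Fin n → ℤ) → ℕ
normMat d n A = maxℕ d (λ i → maxℕ n (λ j → ∣ A i j ∣))

normVecℤ : (d : ℕ) → (Fin d → ℤ) → ℕ
normVecℤ d b = maxℕ d (λ i → ∣ b i ∣)

{-# OPTIONS --safe #-}
-- Put r = Ax − b, β_j = x_j + s_j and S = Σ β_j + s_{n+1}. Then the aggregated equation says
-- that the base-M number with low digits r_i and high part y = Σ M^j (β_j − u_j) + M^n (S − U)
-- vanishes. Since |r_i| ≤ Δ·S + B, carrying through the d low digits gives (M−1)|y| ≤ Δ·S + B.
-- If S > U, then y ≥ S − U because the digits u_j are < M, and that contradicts the bound. So
-- S ≤ U, and then (M−1)|y| < M − 1, which forces y = 0 and all r_i = 0. What remains is
-- Σ M^j β_j + M^n S = Σ M^j u_j + M^n U. Among all representations of a number with digits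
-- in base M, the canonical one (all digits < M) has the strictly smallest digit sum, and
-- Σ β_j + S ≤ 2U = Σ u_j + U. Hence β = u and S = U.
module Submission where

open import Defs
open import Data.Nat as ℕ
  using (ℕ; zero; suc; _+_; _*_; _∸_; _^_; _≤_; _<_; _⊔_; _≤?_; z≤n; s≤s; NonZero; >-nonZero)
open import Data.Nat.Properties
open import Data.Nat.DivMod using (_/_; _%_; m≡m%n+[m/n]*n; [m+kn]%n≡m%n; m<n⇒m%n≡m)
open import Data.Integer as ℤ using (ℤ; +_; ∣_∣)
import Data.Integer.Properties as ℤ
import Data.Nat.Tactic.RingSolver as ℕ
import Data.Integer.Tactic.RingSolver as ℤ
open import Data.Fin using (Fin; zero; suc; toℕ; inject₁; fromℕ)
open import Data.Product using (_×_; _,_; proj₁; proj₂)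
open import Data.Sum using (inj₁; inj₂)
open import Data.Empty using (⊥; ⊥-elim)
open import Function using (_∘_)
open import Function.Bundles using (_⇔_; mk⇔)
open import Relation.Binary.PropositionalEquality
open import Relation.Nullary using (yes; no)

Σℕ-cong : ∀ n {f g : Fin n → ℕ} → (∀ j → f j ≡ g j) → Σℕ n f ≡ Σℕ n g
Σℕ-cong zero    f≗g = refl
Σℕ-cong (suc n) f≗g = cong₂ _+_ (f≗g zero) (Σℕ-cong n (f≗g ∘ suc))

Σℕ-mono-≤ : ∀ n {f g : Fin n → ℕ} → (∀ j → f j ≤ g j) → Σℕ n f ≤ Σℕ n g
Σℕ-mono-≤ zero    f≤g = z≤n
Σℕ-mono-≤ (suc n) f≤g = +-mono-≤ (f≤g zero) (Σℕ-mono-≤ n (f≤g ∘ suc))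

Σℤ-cong : ∀ n {f g : Fin n → ℤ} → (∀ j → f j ≡ g j) → Σℤ n f ≡ Σℤ n g
Σℤ-cong zero    f≗g = refl
Σℤ-cong (suc n) f≗g = cong₂ ℤ._+_ (f≗g zero) (Σℤ-cong n (f≗g ∘ suc))

Σℤ-*ˡ : ∀ n a (f : Fin n → ℤ) → Σℤ n (λ j → a ℤ.* f j) ≡ a ℤ.* Σℤ n f
Σℤ-*ˡ zero    a f = sym (ℤ.*-zeroʳ a)
Σℤ-*ˡ (suc n) a f = trans (cong (ℤ._+_ (a ℤ.* f zero)) (Σℤ-*ˡ n a (f ∘ suc)))
                          (sym (ℤ.*-distribˡ-+ a (f zero) _))

maxℕ-upper : ∀ n (f : Fin n → ℕ) j → f j ≤ maxℕ n f
maxℕ-upper (suc n) f zero    = m≤m⊔n _ _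
maxℕ-upper (suc n) f (suc j) = ≤-trans (maxℕ-upper n (f ∘ suc) j) (m≤n⊔m (f zero) _)

∣Σa*x∣≤Δ*Σx : ∀ n (a : Fin n → ℤ) (x : Fin n → ℕ) {Δ} → (∀ j → ∣ a j ∣ ≤ Δ) →
              ∣ Σℤ n (λ j → a j ℤ.* + x j) ∣ ≤ Δ * Σℕ n x
∣Σa*x∣≤Δ*Σx zero    a x a≤Δ = z≤n
∣Σa*x∣≤Δ*Σx (suc n) a x {Δ} a≤Δ = begin
  ∣ a zero ℤ.* + x zero ℤ.+ rest ∣       ≤⟨ ℤ.∣i+j∣≤∣i∣+∣j∣ (a zero ℤ.* + x zero) rest ⟩
  ∣ a zero ℤ.* + x zero ∣ + ∣ rest ∣     ≡⟨ cong (_+ ∣ rest ∣) (ℤ.abs-* (a zero) (+ x zero)) ⟩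
  ∣ a zero ∣ * x zero + ∣ rest ∣         ≤⟨ +-mono-≤ (*-monoˡ-≤ (x zero) (a≤Δ zero))
                                                     (∣Σa*x∣≤Δ*Σx n (a ∘ suc) (x ∘ suc) (a≤Δ ∘ suc)) ⟩
  Δ * x zero + Δ * Σℕ n (x ∘ suc)         ≡⟨ *-distribˡ-+ Δ (x zero) _ ⟨
  Δ * Σℕ (suc n) x                        ∎
  where
  open ≤-Reasoning
  rest = Σℤ n (λ j → a (suc j) ℤ.* + x (suc j))

m∸n≤∣+m-+n∣ : ∀ m n → m ∸ n ≤ ∣ + m ℤ.- + n ∣
m∸n≤∣+m-+n∣ m n with ≤-total n m
... | inj₁ n≤m = ≤-reflexive (sym (cong ∣_∣ (trans (ℤ.[+m]-[+n]≡m⊖n m n) (ℤ.⊖-≥ n≤m))))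
... | inj₂ m≤n = ≤-trans (≤-reflexive (m≤n⇒m∸n≡0 m≤n)) z≤n

n*k<n⇒k≡0 : ∀ n k → n * k < n → k ≡ 0
n*k<n⇒k≡0 n zero    _     = refl
n*k<n⇒k≡0 n (suc k) nk<n = ⊥-elim (<-irrefl refl (<-≤-trans nk<n (m≤m*n n (suc k))))

top-gap : ∀ N {P R} U e → R < N * suc U → N * (suc U + e) ≤ P → suc e ≤ P ∸ R
top-gap zero    U e ()
top-gap (suc N) {P} {R} U e R<NU NS≤P = m+n≤o⇒m≤o∸n (suc e) (begin
  suc e + R                  ≡⟨ cong suc (+-comm e R) ⟩
  suc R + e                  ≤⟨ +-mono-≤ R<NU (m≤n*m e (suc N)) ⟩
  suc N * suc U + suc N * e  ≡⟨ *-distribˡ-+ (suc N) (suc U) e ⟨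
  suc N * (suc U + e)        ≤⟨ NS≤P ⟩
  P                          ∎)
  where open ≤-Reasoning

no-overflow : ∀ {m} U e {Δ B} → m * suc e ≤ Δ * (suc U + e) + B → Δ * U + B + Δ < m → ⊥
no-overflow {m} U e {Δ} {B} me≤ H = <-irrefl refl (begin-strict
  m * suc e                  ≤⟨ me≤ ⟩
  Δ * (suc U + e) + B        ≡⟨ regroup Δ U e B ⟩
  (Δ * U + B + Δ) + Δ * e    <⟨ +-monoˡ-< (Δ * e) H ⟩
  m + Δ * e                  ≤⟨ +-monoʳ-≤ m (*-monoˡ-≤ e Δ≤m) ⟩
  m + m * e                  ≡⟨ *-suc m e ⟨
  m * suc e                  ∎)
  where
  open ≤-Reasoning
  Δ≤m : Δ ≤ m
  Δ≤m = ≤-trans (m≤n+m Δ _) (<⇒≤ H)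
  regroup : ∀ Δ U e B → Δ * (suc U + e) + B ≡ (Δ * U + B + Δ) + Δ * e
  regroup = ℕ.solve-∀

top-digit-bounded : ∀ N {P R} S U {Δ B m} → R < N * suc U → N * S ≤ P →
                    m * (P ∸ R) ≤ Δ * S + B → Δ * U + B + Δ < m → S ≤ U
top-digit-bounded N S U {Δ} {B} {m} R<N[U+1] NS≤P bound H with S ≤? U
... | yes S≤U = S≤U
... | no  S≰U with m≤n⇒∃[o]m+o≡n (≰⇒> S≰U)
...   | e , refl =
  ⊥-elim (no-overflow U e {Δ} {B} (≤-trans (*-monoʳ-≤ m (top-gap N U e R<N[U+1] NS≤P)) bound) H)

LinearSystem : (d n : ℕ) → (Fin d → Fin n → ℤ) → (Fin d → ℤ) → (Fin n → ℕ) →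
               (Fin n → ℕ) → (Fin (suc n) → ℕ) → Set
LinearSystem d n A b u x s =
  (∀ i → Σℤ n (λ j → A i j ℤ.* + x j) ≡ b i)
  × (∀ j → x j + s (inject₁ j) ≡ u j)
  × (Σℕ n (λ j → x j + s (inject₁ j)) + s (fromℕ n) ≡ Σℕ n u)

AggregatedEquation : (M d n : ℕ) → (Fin d → Fin n → ℤ) → (Fin d → ℤ) → (Fin n → ℕ) →
                     (Fin n → ℕ) → (Fin (suc n) → ℕ) → Set
AggregatedEquation M d n A b u x s =
  Σℤ d (λ i → (+ M) ℤ.^ toℕ i ℤ.* Σℤ n (λ j → A i j ℤ.* + x j))
    ℤ.+ Σℤ n (λ j → (+ M) ℤ.^ (d + toℕ j) ℤ.* + (x j + s (inject₁ j)))
    ℤ.+ (+ M) ℤ.^ (d + n) ℤ.* + (Σℕ n (λ j → x j + s (inject₁ j)) + s (fromℕ n))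
  ≡ Σℤ d (λ i → (+ M) ℤ.^ toℕ i ℤ.* b i)
    ℤ.+ Σℤ n (λ j → (+ M) ℤ.^ (d + toℕ j) ℤ.* + u j)
    ℤ.+ (+ M) ℤ.^ (d + n) ℤ.* + Σℕ n u

system⇒aggregated : ∀ M d n A b u x s → LinearSystem d n A b u x s → AggregatedEquation M d n A b u x s
system⇒aggregated M d n A b u x s (Ax≡b , x+s≡u , Σ≡U) =
  cong₂ ℤ._+_ (cong₂ ℤ._+_ (Σℤ-cong d (λ i → cong ((+ M) ℤ.^ toℕ i ℤ.*_) (Ax≡b i)))
                           (Σℤ-cong n (λ j → cong (λ v → (+ M) ℤ.^ (d + toℕ j) ℤ.* + v) (x+s≡u j))))
              (cong (λ v → (+ M) ℤ.^ (d + n) ℤ.* + v) Σ≡U)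

module Base (m : ℕ) where

  M : ℕ
  M = suc m

  Mℤ : ℤ
  Mℤ = + M

  horner : (K : ℕ) → (Fin K → ℤ) → ℤ → ℤ
  horner zero    c z = z
  horner (suc K) c z = c zero ℤ.+ Mℤ ℤ.* horner K (c ∘ suc) z

  hornerℕ : (K : ℕ) → (Fin K → ℕ) → ℕ → ℕ
  hornerℕ zero    a t = t
  hornerℕ (suc K) a t = a zero + M * hornerℕ K (a ∘ suc) t

  pos-hornerℕ : ∀ K (a : Fin K → ℕ) t → + hornerℕ K a t ≡ horner K (+_ ∘ a) (+ t)
  pos-hornerℕ zero    a t = refl
  pos-hornerℕ (suc K) a t =
    trans (ℤ.pos-+ (a zero) _)
          (cong (ℤ._+_ (+ a zero)) (trans (ℤ.pos-* M _) (cong (ℤ._*_ Mℤ) (pos-hornerℕ K (a ∘ suc) t))))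

  horner≡Σ : ∀ K (c : Fin K → ℤ) z →
             horner K c z ≡ Σℤ K (λ i → Mℤ ℤ.^ toℕ i ℤ.* c i) ℤ.+ Mℤ ℤ.^ K ℤ.* z
  horner≡Σ zero    c z = sym (trans (ℤ.+-identityˡ _) (ℤ.*-identityˡ z))
  horner≡Σ (suc K) c z = begin
    c zero ℤ.+ Mℤ ℤ.* horner K (c ∘ suc) z
      ≡⟨ cong (λ h → c zero ℤ.+ Mℤ ℤ.* h) (horner≡Σ K (c ∘ suc) z) ⟩
    c zero ℤ.+ Mℤ ℤ.* (Σ′ ℤ.+ Mℤ ℤ.^ K ℤ.* z)
      ≡⟨ regroup (c zero) Mℤ Σ′ (Mℤ ℤ.^ K) z ⟩
    ℤ.1ℤ ℤ.* c zero ℤ.+ Mℤ ℤ.* Σ′ ℤ.+ Mℤ ℤ.^ suc K ℤ.* z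
      ≡⟨ cong (λ t → ℤ.1ℤ ℤ.* c zero ℤ.+ t ℤ.+ Mℤ ℤ.^ suc K ℤ.* z) shift ⟨
    Σℤ (suc K) (λ i → Mℤ ℤ.^ toℕ i ℤ.* c i) ℤ.+ Mℤ ℤ.^ suc K ℤ.* z
      ∎
    where
    open ≡-Reasoning
    Σ′ = Σℤ K (λ i → Mℤ ℤ.^ toℕ i ℤ.* c (suc i))
    shift : Σℤ K (λ i → Mℤ ℤ.^ suc (toℕ i) ℤ.* c (suc i)) ≡ Mℤ ℤ.* Σ′
    shift = trans (Σℤ-cong K (λ i → ℤ.*-assoc Mℤ (Mℤ ℤ.^ toℕ i) (c (suc i)))) (Σℤ-*ˡ K Mℤ _)
    regroup : ∀ c a s p z → c ℤ.+ a ℤ.* (s ℤ.+ p ℤ.* z) ≡ ℤ.1ℤ ℤ.* c ℤ.+ a ℤ.* s ℤ.+ (a ℤ.* p) ℤ.* z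
    regroup = ℤ.solve-∀

  aggregate≡horner : ∀ d n (α : Fin d → ℤ) (β : Fin n → ℕ) S →
    Σℤ d (λ i → Mℤ ℤ.^ toℕ i ℤ.* α i)
      ℤ.+ Σℤ n (λ j → Mℤ ℤ.^ (d + toℕ j) ℤ.* + β j)
      ℤ.+ Mℤ ℤ.^ (d + n) ℤ.* + S
    ≡ horner d α (+ hornerℕ n β S)
  aggregate≡horner d n α β S = begin
    Σα ℤ.+ Σℤ n (λ j → Mℤ ℤ.^ (d + toℕ j) ℤ.* + β j) ℤ.+ Mℤ ℤ.^ (d + n) ℤ.* + S
      ≡⟨ cong₂ (λ p q → Σα ℤ.+ p ℤ.+ q) shift
               (trans (cong (ℤ._* + S) (ℤ.^-distribˡ-+-* Mℤ d n)) (ℤ.*-assoc D _ _)) ⟩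
    Σα ℤ.+ D ℤ.* Σβ ℤ.+ D ℤ.* (Mℤ ℤ.^ n ℤ.* + S)
      ≡⟨ trans (ℤ.+-assoc Σα _ _) (cong (ℤ._+_ Σα) (sym (ℤ.*-distribˡ-+ D Σβ _))) ⟩
    Σα ℤ.+ D ℤ.* (Σβ ℤ.+ Mℤ ℤ.^ n ℤ.* + S)
      ≡⟨ cong (λ h → Σα ℤ.+ D ℤ.* h) (trans (pos-hornerℕ n β S) (horner≡Σ n (+_ ∘ β) (+ S))) ⟨
    Σα ℤ.+ D ℤ.* + hornerℕ n β S
      ≡⟨ horner≡Σ d α _ ⟨
    horner d α (+ hornerℕ n β S)
      ∎
    where
    open ≡-Reasoning
    D = Mℤ ℤ.^ d
    Σα = Σℤ d (λ i → Mℤ ℤ.^ toℕ i ℤ.* α i)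
    Σβ = Σℤ n (λ j → Mℤ ℤ.^ toℕ j ℤ.* + β j)
    shift : Σℤ n (λ j → Mℤ ℤ.^ (d + toℕ j) ℤ.* + β j) ≡ D ℤ.* Σβ
    shift = trans (Σℤ-cong n (λ j → trans (cong (ℤ._* + β j) (ℤ.^-distribˡ-+-* Mℤ d (toℕ j)))
                                          (ℤ.*-assoc D _ _)))
                  (Σℤ-*ˡ n D _)

  horner-sub : ∀ K (f g : Fin K → ℤ) y z →
               horner K f y ℤ.- horner K g z ≡ horner K (λ i → f i ℤ.- g i) (y ℤ.- z)
  horner-sub zero    f g y z = refl
  horner-sub (suc K) f g y z =
    trans (regroup (f zero) (g zero) Mℤ (horner K (f ∘ suc) y) (horner K (g ∘ suc) z))
          (cong (λ h → f zero ℤ.- g zero ℤ.+ Mℤ ℤ.* h) (horner-sub K (f ∘ suc) (g ∘ suc) y z))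
    where
    regroup : ∀ a b p s t → a ℤ.+ p ℤ.* s ℤ.- (b ℤ.+ p ℤ.* t) ≡ a ℤ.- b ℤ.+ p ℤ.* (s ℤ.- t)
    regroup = ℤ.solve-∀

  M*∣w∣≤∣z∣+∣c∣ : ∀ c w z → c ℤ.+ Mℤ ℤ.* w ≡ z → M * ∣ w ∣ ≤ ∣ z ∣ + ∣ c ∣
  M*∣w∣≤∣z∣+∣c∣ c w z eq = begin
    M * ∣ w ∣          ≡⟨ ℤ.abs-* Mℤ w ⟨
    ∣ Mℤ ℤ.* w ∣        ≡⟨ cong ∣_∣ (trans (cancel c (Mℤ ℤ.* w)) (cong (ℤ._- c) eq)) ⟩
    ∣ z ℤ.- c ∣         ≤⟨ ℤ.∣i-j∣≤∣i∣+∣j∣ z c ⟩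
    ∣ z ∣ + ∣ c ∣       ∎
    where
    open ≤-Reasoning
    cancel : ∀ c x → x ≡ c ℤ.+ x ℤ.- c
    cancel = ℤ.solve-∀

  -- Generalised over the value z so that the invariant m·|z| ≤ B can be passed down the digits.
  carry-bound : ∀ K (c : Fin K → ℤ) y z {B} → (∀ i → ∣ c i ∣ ≤ B) →
                m * ∣ z ∣ ≤ B → horner K c y ≡ z → m * ∣ y ∣ ≤ B
  carry-bound zero    c y z c≤B mz≤B refl = mz≤B
  carry-bound (suc K) c y z {B} c≤B mz≤B eq =
    carry-bound K (c ∘ suc) y w (c≤B ∘ suc) (*-cancelˡ-≤ M mw≤B) refl
    where
    open ≤-Reasoning
    w = horner K (c ∘ suc) y
    *-comm-middle : ∀ a b c → a * (b * c) ≡ b * (a * c)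
    *-comm-middle = ℕ.solve-∀
    mw≤B : M * (m * ∣ w ∣) ≤ M * B
    mw≤B = begin
      M * (m * ∣ w ∣)          ≡⟨ *-comm-middle M m ∣ w ∣ ⟩
      m * (M * ∣ w ∣)          ≤⟨ *-monoʳ-≤ m (M*∣w∣≤∣z∣+∣c∣ (c zero) w z eq) ⟩
      m * (∣ z ∣ + ∣ c zero ∣) ≡⟨ *-distribˡ-+ m ∣ z ∣ _ ⟩
      m * ∣ z ∣ + m * ∣ c zero ∣ ≤⟨ +-mono-≤ mz≤B (*-monoʳ-≤ m (c≤B zero)) ⟩
      B + m * B                ∎

  c+M*w≡0⇒c≡0×w≡0 : ∀ c w → ∣ c ∣ ≤ m → c ℤ.+ Mℤ ℤ.* w ≡ + 0 → c ≡ + 0 × w ≡ + 0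
  c+M*w≡0⇒c≡0×w≡0 c w c≤m eq = c≡0 , w≡0
    where
    open ≡-Reasoning
    w≡0 : w ≡ + 0
    w≡0 = ℤ.∣i∣≡0⇒i≡0 (n*k<n⇒k≡0 M ∣ w ∣ (s≤s (≤-trans (M*∣w∣≤∣z∣+∣c∣ c w _ eq) c≤m)))
    c≡0 : c ≡ + 0
    c≡0 = begin
      c                   ≡⟨ ℤ.+-identityʳ c ⟨
      c ℤ.+ + 0           ≡⟨ cong (ℤ._+_ c) (ℤ.*-zeroʳ Mℤ) ⟨
      c ℤ.+ Mℤ ℤ.* + 0    ≡⟨ cong (λ v → c ℤ.+ Mℤ ℤ.* v) w≡0 ⟨
      c ℤ.+ Mℤ ℤ.* w      ≡⟨ eq ⟩
      + 0                 ∎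

  horner≡0⇒c≡0 : ∀ K (c : Fin K → ℤ) → (∀ i → ∣ c i ∣ ≤ m) → horner K c (+ 0) ≡ + 0 →
                 ∀ i → c i ≡ + 0
  horner≡0⇒c≡0 (suc K) c c≤m eq zero    = proj₁ (c+M*w≡0⇒c≡0×w≡0 (c zero) _ (c≤m zero) eq)
  horner≡0⇒c≡0 (suc K) c c≤m eq (suc i) =
    horner≡0⇒c≡0 K (c ∘ suc) (c≤m ∘ suc) (proj₂ (c+M*w≡0⇒c≡0×w≡0 (c zero) _ (c≤m zero) eq)) i

  hornerℕ-lower : ∀ K (a : Fin K → ℕ) t → M ^ K * t ≤ hornerℕ K a t
  hornerℕ-lower zero    a t = ≤-reflexive (*-identityˡ t)
  hornerℕ-lower (suc K) a t = begin
    M * M ^ K * t              ≡⟨ *-assoc M (M ^ K) t ⟩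
    M * (M ^ K * t)            ≤⟨ *-monoʳ-≤ M (hornerℕ-lower K (a ∘ suc) t) ⟩
    M * hornerℕ K (a ∘ suc) t  ≤⟨ m≤n+m _ (a zero) ⟩
    hornerℕ (suc K) a t        ∎
    where open ≤-Reasoning

  hornerℕ-upper : ∀ K (a : Fin K → ℕ) t → (∀ j → a j ≤ m) → hornerℕ K a t < M ^ K * suc t
  hornerℕ-upper zero    a t a≤m = ≤-reflexive (sym (*-identityˡ (suc t)))
  hornerℕ-upper (suc K) a t a≤m = begin-strict
    a zero + M * h             <⟨ +-monoˡ-< (M * h) (s≤s (a≤m zero)) ⟩
    M + M * h                  ≡⟨ *-suc M h ⟨
    M * suc h                  ≤⟨ *-monoʳ-≤ M (hornerℕ-upper K (a ∘ suc) t (a≤m ∘ suc)) ⟩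
    M * (M ^ K * suc t)        ≡⟨ *-assoc M (M ^ K) (suc t) ⟨
    M ^ suc K * suc t          ∎
    where
    open ≤-Reasoning
    h = hornerℕ K (a ∘ suc) t

  split-low-digit : ∀ x y r y′ → r ≤ m → x + M * y ≡ r + M * y′ →
                    x ≡ r + (x / M) * M × x / M + y ≡ y′
  split-low-digit x y r y′ r≤m eq = x≡ , *-cancelˡ-≡ (q + y) y′ M (+-cancelˡ-≡ r _ _ shifted)
    where
    open ≡-Reasoning
    q = x / M
    x%M≡r : x % M ≡ r
    x%M≡r = begin
      x % M               ≡⟨ [m+kn]%n≡m%n x y M ⟨
      (x + y * M) % M     ≡⟨ cong (_% M) (trans (cong (_+_ x) (*-comm y M)) (trans eq (cong (_+_ r) (*-comm M y′)))) ⟩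
      (r + y′ * M) % M    ≡⟨ [m+kn]%n≡m%n r y′ M ⟩
      r % M               ≡⟨ m<n⇒m%n≡m (s≤s r≤m) ⟩
      r                   ∎
    x≡ : x ≡ r + q * M
    x≡ = trans (m≡m%n+[m/n]*n x M) (cong (_+ q * M) x%M≡r)
    shifted : r + M * (q + y) ≡ r + M * y′
    shifted = begin
      r + M * (q + y)     ≡⟨ regroup r M q y ⟩
      r + q * M + M * y   ≡⟨ cong (_+ M * y) x≡ ⟨
      x + M * y           ≡⟨ eq ⟩
      r + M * y′          ∎
      where
      regroup : ∀ r M q y → r + M * (q + y) ≡ r + q * M + M * y
      regroup = ℕ.solve-∀

  carry-vanishes : ∀ {{_ : NonZero m}} {c x y} → c + x ≡ y → c * M + x ≤ y → c ≡ 0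
  carry-vanishes {c} {x} eq le = m*n≡0⇒m≡0 c m (n≤0⇒n≡0 (+-cancelˡ-≤ c _ 0 (begin
    c + c * m    ≡⟨ *-suc c m ⟨
    c * M        ≤⟨ +-cancelʳ-≤ x _ _ (subst (c * M + x ≤_) (sym eq) le) ⟩
    c            ≡⟨ +-identityʳ c ⟨
    c + 0        ∎)))
    where open ≤-Reasoning

  -- c is a carry into the lowest digit; weighting it by M in the digit sum is what lets the
  -- statement pass through the induction.
  digit-sum-minimal : ∀ {{_ : NonZero m}} K (a u : Fin K → ℕ) (t v c : ℕ) → (∀ j → u j ≤ m) →
                      c + hornerℕ K a t ≡ hornerℕ K u v → c * M + (Σℕ K a + t) ≤ Σℕ K u + v →
                      c ≡ 0 × (∀ j → a j ≡ u j) × t ≡ v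
  digit-sum-minimal zero a u t v c u≤m eq le = c≡0 , (λ ()) , subst (λ c → c + t ≡ v) c≡0 eq
    where
    c≡0 = carry-vanishes eq le
  digit-sum-minimal (suc K) a u t v c u≤m eq le =
    c≡0 , (λ { zero → subst (λ c → c + a zero ≡ u zero) c≡0 c+a₀≡u₀ ; (suc j) → tail≡ j }) , t≡v
    where
    open ≤-Reasoning
    Ta = Σℕ K (a ∘ suc) + t
    Tu = Σℕ K (u ∘ suc) + v
    regroup : ∀ w a₀ s t → w + a₀ + (s + t) ≡ w + (a₀ + s + t)
    regroup = ℕ.solve-∀
    split = split-low-digit (c + a zero) (hornerℕ K (a ∘ suc) t) (u zero) (hornerℕ K (u ∘ suc) v)
                      (u≤m zero) (trans (+-assoc c (a zero) _) eq)
    q = (c + a zero) / M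
    c+a₀≡ : c + a zero ≡ u zero + q * M
    c+a₀≡ = proj₁ split
    c*M+a₀+Ta≤u₀+Tu : c * M + a zero + Ta ≤ u zero + Tu
    c*M+a₀+Ta≤u₀+Tu = begin
      c * M + a zero + Ta            ≡⟨ regroup (c * M) (a zero) _ t ⟩
      c * M + (Σℕ (suc K) a + t)     ≤⟨ le ⟩
      Σℕ (suc K) u + v               ≡⟨ +-assoc (u zero) _ v ⟩
      u zero + Tu                    ∎
    IH = digit-sum-minimal K (a ∘ suc) (u ∘ suc) t v q (u≤m ∘ suc) (proj₂ split)
           (+-cancelˡ-≤ (u zero) _ _ (begin
             u zero + (q * M + Ta)     ≡⟨ +-assoc (u zero) (q * M) Ta ⟨
             u zero + q * M + Ta       ≡⟨ cong (_+ Ta) c+a₀≡ ⟨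
             c + a zero + Ta           ≤⟨ +-monoˡ-≤ Ta (+-monoˡ-≤ (a zero) (m≤m*n c M)) ⟩
             c * M + a zero + Ta       ≤⟨ c*M+a₀+Ta≤u₀+Tu ⟩
             u zero + Tu               ∎))
    tail≡ = proj₁ (proj₂ IH)
    t≡v = proj₂ (proj₂ IH)
    c+a₀≡u₀ : c + a zero ≡ u zero
    c+a₀≡u₀ = trans c+a₀≡ (trans (cong (λ q → u zero + q * M) (proj₁ IH)) (+-identityʳ (u zero)))
    c≡0 : c ≡ 0
    c≡0 = carry-vanishes c+a₀≡u₀ (+-cancelʳ-≤ Ta _ _ (begin
      c * M + a zero + Ta    ≤⟨ c*M+a₀+Ta≤u₀+Tu ⟩
      u zero + Tu            ≡⟨ cong (_+_ (u zero)) (cong₂ _+_ (Σℕ-cong K tail≡) t≡v) ⟨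
      u zero + Ta            ∎))

  aggregation-injective : ∀ d n (α b : Fin d → ℤ) (β u : Fin n → ℕ) S U Δ B →
    Δ * U + B + Δ < m → (∀ j → u j ≤ m) → Σℕ n u ≡ U → Σℕ n β ≤ S →
    (∀ i → ∣ α i ℤ.- b i ∣ ≤ Δ * S + B) →
    horner d α (+ hornerℕ n β S) ≡ horner d b (+ hornerℕ n u U) →
    (∀ i → α i ≡ b i) × (∀ j → β j ≡ u j) × S ≡ U
  aggregation-injective d n α b β u S U Δ B H u≤m Σu≡U Σβ≤S α-b≤ eq =
    (λ i → ℤ.i-j≡0⇒i≡j (α i) (b i) (α-b≡0 i)) , proj₂ (digit-sum-minimal n β u S U 0 u≤m P≡R digit-sums)
    where
    instance
      m≢0 : NonZero m
      m≢0 = >-nonZero (≤-trans (s≤s z≤n) H)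
    P = hornerℕ n β S
    R = hornerℕ n u U
    y = + P ℤ.- + R
    diff : horner d (λ i → α i ℤ.- b i) y ≡ + 0
    diff = trans (sym (horner-sub d α b _ _)) (ℤ.i≡j⇒i-j≡0 eq)
    my≤ : m * ∣ y ∣ ≤ Δ * S + B
    my≤ = carry-bound d _ y (+ 0) α-b≤ (≤-trans (≤-reflexive (*-zeroʳ m)) z≤n) diff
    S≤U : S ≤ U
    S≤U = top-digit-bounded (M ^ n) S U {Δ} {B} (hornerℕ-upper n u U u≤m) (hornerℕ-lower n β S)
            (≤-trans (*-monoʳ-≤ m (m∸n≤∣+m-+n∣ P R)) my≤) H
    ΔS+B<m : Δ * S + B < m
    ΔS+B<m = ≤-<-trans (+-monoˡ-≤ B (*-monoʳ-≤ Δ S≤U)) (≤-<-trans (m≤m+n _ Δ) H)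
    y≡0 : y ≡ + 0
    y≡0 = ℤ.∣i∣≡0⇒i≡0 (n*k<n⇒k≡0 m ∣ y ∣ (≤-<-trans my≤ ΔS+B<m))
    α-b≡0 : ∀ i → α i ℤ.- b i ≡ + 0
    α-b≡0 = horner≡0⇒c≡0 d _ (λ i → ≤-trans (α-b≤ i) (<⇒≤ ΔS+B<m))
              (subst (λ y → horner d _ y ≡ + 0) y≡0 diff)
    P≡R : P ≡ R
    P≡R = ℤ.+-injective (ℤ.i-j≡0⇒i≡j (+ P) (+ R) y≡0)
    digit-sums : Σℕ n β + S ≤ Σℕ n u + U
    digit-sums = ≤-trans (+-mono-≤ (≤-trans Σβ≤S S≤U) S≤U) (≤-reflexive (cong (_+ U) (sym Σu≡U)))

  aggregation-⇔ : ∀ d n (A : Fin d → Fin n → ℤ) (b : Fin d → ℤ) (u : Fin n → ℕ) x s {Δ B} →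
    (∀ i j → ∣ A i j ∣ ≤ Δ) → (∀ i → ∣ b i ∣ ≤ B) → (∀ j → u j ≤ m) → Δ * Σℕ n u + B + Δ < m →
    LinearSystem d n A b u x s ⇔ AggregatedEquation M d n A b u x s
  aggregation-⇔ d n A b u x s {Δ} {B} A≤Δ b≤B u≤m H = mk⇔ (system⇒aggregated M d n A b u x s) λ eq →
    aggregation-injective d n α b β u S (Σℕ n u) Δ B H u≤m refl Σβ≤S α-b≤
      (trans (sym (aggregate≡horner d n α β S)) (trans eq (aggregate≡horner d n b u _)))
    where
    α : Fin d → ℤ
    α i = Σℤ n (λ j → A i j ℤ.* + x j)
    β : Fin n → ℕ
    β j = x j + s (inject₁ j)
    S : ℕ
    S = Σℕ n β + s (fromℕ n)
    Σβ≤S : Σℕ n β ≤ S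
    Σβ≤S = m≤m+n _ _
    Σx≤S : Σℕ n x ≤ S
    Σx≤S = ≤-trans (Σℕ-mono-≤ n (λ j → m≤m+n (x j) _)) Σβ≤S
    α-b≤ : ∀ i → ∣ α i ℤ.- b i ∣ ≤ Δ * S + B
    α-b≤ i = ≤-trans (ℤ.∣i-j∣≤∣i∣+∣j∣ (α i) (b i))
                     (+-mono-≤ (≤-trans (∣Σa*x∣≤Δ*Σx n (A i) x (A≤Δ i)) (*-monoʳ-≤ Δ Σx≤S)) (b≤B i))

lemma2 : (d n : ℕ) (A : Fin d → Fin n → ℤ) (b : Fin d → ℤ) (u : Fin n → ℕ)
    (x : Fin n → ℕ) (s : Fin (suc n) → ℕ) →
    let Δ = normMat d n A
        U = Σℕ n u
        M = Δ ℕ.* U ℕ.+ (normVecℤ d b ⊔ maxℕ n u) ℕ.+ Δ ℕ.+ 2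
        Mz = + M
    in ((∀ (i : Fin d) → Σℤ n (λ j → A i j ℤ.* + x j) ≡ b i)
        × (∀ (j : Fin n) → x j ℕ.+ s (inject₁ j) ≡ u j)
        × (Σℕ n (λ j → x j ℕ.+ s (inject₁ j)) ℕ.+ s (fromℕ n) ≡ U))
      ⇔
      (Σℤ d (λ i → Mz ℤ.^ toℕ i ℤ.* Σℤ n (λ j → A i j ℤ.* + x j))
         ℤ.+ Σℤ n (λ j → Mz ℤ.^ (d ℕ.+ toℕ j) ℤ.* + (x j ℕ.+ s (inject₁ j)))
         ℤ.+ Mz ℤ.^ (d ℕ.+ n) ℤ.* + (Σℕ n (λ j → x j ℕ.+ s (inject₁ j)) ℕ.+ s (fromℕ n))
       ≡ Σℤ d (λ i → Mz ℤ.^ toℕ i ℤ.* b i)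
         ℤ.+ Σℤ n (λ j → Mz ℤ.^ (d ℕ.+ toℕ j) ℤ.* + u j)
         ℤ.+ Mz ℤ.^ (d ℕ.+ n) ℤ.* + U)
lemma2 d n A b u x s =
  subst (λ M → LinearSystem d n A b u x s ⇔ AggregatedEquation M d n A b u x s) (+-comm 2 k)
        (Base.aggregation-⇔ (suc k) d n A b u x s A≤Δ b≤B u≤1+k (s≤s ΔU+B+Δ≤k))
  where
  Δ = normMat d n A
  B = normVecℤ d b
  U = Σℕ n u
  μ = maxℕ n u
  k = Δ * U + (B ⊔ μ) + Δ
  A≤Δ : ∀ i j → ∣ A i j ∣ ≤ Δ
  A≤Δ i j = ≤-trans (maxℕ-upper n _ j) (maxℕ-upper d _ i)
  b≤B : ∀ i → ∣ b i ∣ ≤ B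
  b≤B = maxℕ-upper d _
  u≤1+k : ∀ j → u j ≤ suc k
  u≤1+k j = ≤-trans (maxℕ-upper n u j)
              (≤-trans (m≤n⊔m B μ) (≤-trans (m≤n+m _ (Δ * U)) (≤-trans (m≤m+n _ Δ) (n≤1+n k))))
  ΔU+B+Δ≤k : Δ * U + B + Δ ≤ k
  ΔU+B+Δ≤k = +-monoˡ-≤ Δ (+-monoʳ-≤ (Δ * U) (m≤m⊔n B μ))
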